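{- $\mathsf{GKur} = \mathsf{MS4} + \blacksquare \Diamond \Box p \to \Diamond \blacksquare p = \mathsf{MS4} + \Box \Diamond\exists p \to \Diamond\exists \Box \Diamond p$.
   Context: $\mathsf{MS4}$ is the bimodal logic in the language with modalities $\Box$ and $\forall$ (with $\Diamond=\neg\Box\neg$, $\exists=\neg\forall\neg$) containing classical propositional logic, the $\mathsf{S4}$-axioms for $\Box$, the $\mathsf{S5}$-axioms for $\forall$, the left commutativity axiom $\Box\forall p\to\forall\Box p$, and closed under modus ponens, substitution and both necessitation rules. $\blacksquare$ denotes the compound modality $\Box\forall$ (an $\mathsf{S4}$ master modality for $\mathsf{MS4}$), and $\mathsf{MS4}\vdash \neg\blacksquare\neg p\leftrightarrow \Diamond\exists p$. $\mathsf{MIPC}$ is the monadic intuitionistic propositional calculus, $\mathsf{kur}=\forall\neg\neg p\to\neg\neg\forall p$ is the monadic Kuroda formula, $\mathsf{Kur}=\mathsf{MIPC}+\mathsf{kur}$. The Gödel translation $(-)^t$ is extended to the monadic setting by $p^t=\Box p$, $(\varphi\to\psi)^t=\Box(\neg\varphi^t\lor\psi^t)$, $(\forall\varphi)^t=\blacksquare\varphi^t$, $(\exists\varphi)^t=\exists\varphi^t$ (commuting with $\bot,\land,\lor$). The global Kuroda logic is $\mathsf{GKur}=\tau(\mathsf{Kur})=\mathsf{MS4}+\{\varphi^t:\mathsf{Kur}\vdash\varphi\}$, which equals $\mathsf{MS4}+\mathsf{kur}^t$. -}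

module Defs where

open import Data.Nat using (ℕ)
open import Data.Bool using (Bool; true; false; _∧_; _∨_; not)
open import Relation.Binary.PropositionalEquality using (_≡_)

-- Bimodal formulas: □ (S4 box) and ∀ (universal modality, written A here)
infixr 5 _⇒_
infixl 7 _∧'_
infixl 6 _∨'_
data Fm : Set where
  var  : ℕ → Fm
  ⊥'   : Fm
  _∧'_ : Fm → Fm → Fm
  _∨'_ : Fm → Fm → Fm
  _⇒_  : Fm → Fm → Fm
  □    : Fm → Fm
  A    : Fm → Fm

¬' : Fm → Fm
¬' φ = φ ⇒ ⊥'

◇ : Fm → Fm
◇ φ = ¬' (□ (¬' φ))

E : Fm → Fm
E φ = ¬' (A (¬' φ))

■ : Fm → Fm
■ φ = □ (A φ)

p q : Fm
p = var 0
q = var 1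

sub : (ℕ → Fm) → Fm → Fm
sub σ (var n)  = σ n
sub σ ⊥'       = ⊥'
sub σ (φ ∧' ψ) = sub σ φ ∧' sub σ ψ
sub σ (φ ∨' ψ) = sub σ φ ∨' sub σ ψ
sub σ (φ ⇒ ψ)  = sub σ φ ⇒ sub σ ψ
sub σ (□ φ)    = □ (sub σ φ)
sub σ (A φ)    = A (sub σ φ)

-- classical propositional evaluation, treating variables and modalised
-- formulas as propositional atoms
eval : (Fm → Bool) → Fm → Bool
eval v (var n)  = v (var n)
eval v ⊥'       = false
eval v (φ ∧' ψ) = eval v φ ∧ eval v ψ
eval v (φ ∨' ψ) = eval v φ ∨ eval v ψ
eval v (φ ⇒ ψ)  = not (eval v φ) ∨ eval v ψ
eval v (□ φ)    = v (□ φ)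
eval v (A φ)    = v (A φ)

Taut : Fm → Set
Taut φ = (v : Fm → Bool) → eval v φ ≡ true

data MS4+_⊢_ (ax : Fm) : Fm → Set where
  taut  : ∀ {φ} → Taut φ → MS4+ ax ⊢ φ
  K□    : MS4+ ax ⊢ (□ (p ⇒ q) ⇒ (□ p ⇒ □ q))
  T□    : MS4+ ax ⊢ (□ p ⇒ p)
  4□    : MS4+ ax ⊢ (□ p ⇒ □ (□ p))
  KA    : MS4+ ax ⊢ (A (p ⇒ q) ⇒ (A p ⇒ A q))
  TA    : MS4+ ax ⊢ (A p ⇒ p)
  5A    : MS4+ ax ⊢ (E p ⇒ A (E p))
  lcom  : MS4+ ax ⊢ (□ (A p) ⇒ A (□ p))
  extra : MS4+ ax ⊢ ax
  mp    : ∀ {φ ψ} → MS4+ ax ⊢ (φ ⇒ ψ) → MS4+ ax ⊢ φ → MS4+ ax ⊢ ψ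
  subst : ∀ {φ} (σ : ℕ → Fm) → MS4+ ax ⊢ φ → MS4+ ax ⊢ sub σ φ
  nec□  : ∀ {φ} → MS4+ ax ⊢ φ → MS4+ ax ⊢ □ φ
  necA  : ∀ {φ} → MS4+ ax ⊢ φ → MS4+ ax ⊢ A φ

data IFm : Set where
  ivar : ℕ → IFm
  i⊥   : IFm
  _i∧_ : IFm → IFm → IFm
  _i∨_ : IFm → IFm → IFm
  _i⇒_ : IFm → IFm → IFm
  i∀   : IFm → IFm
  i∃   : IFm → IFm

i¬ : IFm → IFm
i¬ φ = φ i⇒ i⊥

_ᵗ : IFm → Fm
ivar n ᵗ   = □ (var n)
i⊥ ᵗ       = ⊥'
(φ i∧ ψ) ᵗ = (φ ᵗ) ∧' (ψ ᵗ)
(φ i∨ ψ) ᵗ = (φ ᵗ) ∨' (ψ ᵗ)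
(φ i⇒ ψ) ᵗ = □ (¬' (φ ᵗ) ∨' (ψ ᵗ))
i∀ φ ᵗ     = ■ (φ ᵗ)
i∃ φ ᵗ     = E (φ ᵗ)

kur : IFm
kur = i∀ (i¬ (i¬ (ivar 0))) i⇒ i¬ (i¬ (i∀ (ivar 0)))

GKur⊢_ : Fm → Set
GKur⊢ φ = MS4+ (kur ᵗ) ⊢ φ

ax₁ ax₂ : Fm
ax₁ = ■ (◇ (□ p)) ⇒ ◇ (■ p)
ax₂ = □ (◇ (E p)) ⇒ ◇ (E (□ (◇ p)))

SameLogic : (Fm → Set) → (Fm → Set) → Set
SameLogic L₁ L₂ = ∀ φ → (L₁ φ → L₂ φ) × (L₂ φ → L₁ φ)
  where open import Data.Product using (_×_)

-- The Gödel translation of intuitionistic double negation is □◇, and in MS4 the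
-- modality ■ absorbs an inner or outer □.  Hence kurᵗ is equivalent to
-- □(■◇□p → □◇■p), which is interderivable with ■◇□p → ◇■p by T and 4 for □.
-- The second axiom is the contrapositive of the first at ¬p, once the De Morgan
-- duality ¬■¬ ↔ ◇∃ is pushed through the modalities.
module Submission where

open import Defs
open import Data.Product using (_×_; _,_)
open import Data.Nat using (zero)
open import Data.Bool using (true; false)
open import Relation.Binary.PropositionalEquality using (refl)

⊢-replace-axiom : ∀ {a b φ} → MS4+ b ⊢ a → MS4+ a ⊢ φ → MS4+ b ⊢ φ
⊢-replace-axiom a (taut t)    = taut t
⊢-replace-axiom a K□          = K□
⊢-replace-axiom a T□          = T□
⊢-replace-axiom a 4□          = 4□
⊢-replace-axiom a KA          = KA
⊢-replace-axiom a TA          = TA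
⊢-replace-axiom a 5A          = 5A
⊢-replace-axiom a lcom        = lcom
⊢-replace-axiom a extra       = a
⊢-replace-axiom a (mp d e)    = mp (⊢-replace-axiom a d) (⊢-replace-axiom a e)
⊢-replace-axiom a (subst σ d) = subst σ (⊢-replace-axiom a d)
⊢-replace-axiom a (nec□ d)    = nec□ (⊢-replace-axiom a d)
⊢-replace-axiom a (necA d)    = necA (⊢-replace-axiom a d)

interderivable⇒SameLogic : ∀ {a b} → MS4+ b ⊢ a → MS4+ a ⊢ b → SameLogic (MS4+ a ⊢_) (MS4+ b ⊢_)
interderivable⇒SameLogic b⊢a a⊢b φ = ⊢-replace-axiom b⊢a , ⊢-replace-axiom a⊢b

module Tautologies where

  syllogism : ∀ a b c → Taut ((a ⇒ b) ⇒ ((b ⇒ c) ⇒ (a ⇒ c)))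
  syllogism a b c v with eval v a | eval v b | eval v c
  ... | true  | true  | true  = refl
  ... | true  | true  | false = refl
  ... | true  | false | true  = refl
  ... | true  | false | false = refl
  ... | false | true  | true  = refl
  ... | false | true  | false = refl
  ... | false | false | true  = refl
  ... | false | false | false = refl

  contraposition : ∀ a b → Taut ((a ⇒ b) ⇒ (¬' b ⇒ ¬' a))
  contraposition a b v with eval v a | eval v b
  ... | true  | true  = refl
  ... | true  | false = refl
  ... | false | true  = refl
  ... | false | false = refl

  ⇒-to-∨ : ∀ a b → Taut ((a ⇒ b) ⇒ (¬' a ∨' b))
  ⇒-to-∨ a b v with eval v a | eval v b
  ... | true  | true  = refl
  ... | true  | false = refl
  ... | false | true  = refl
  ... | false | false = refl

  ∨-to-⇒ : ∀ a b → Taut ((¬' a ∨' b) ⇒ (a ⇒ b))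
  ∨-to-⇒ a b v with eval v a | eval v b
  ... | true  | true  = refl
  ... | true  | false = refl
  ... | false | true  = refl
  ... | false | false = refl

  ¬¬-elim : ∀ a → Taut (¬' (¬' a) ⇒ a)
  ¬¬-elim a v with eval v a
  ... | true  = refl
  ... | false = refl

  ¬¬-intro : ∀ a → Taut (a ⇒ ¬' (¬' a))
  ¬¬-intro a v with eval v a
  ... | true  = refl
  ... | false = refl

module MS4-Reasoning {ax : Fm} where

  private
    variable
      a b c : Fm

  infixl 4 _⨾_
  _⨾_ : MS4+ ax ⊢ (a ⇒ b) → MS4+ ax ⊢ (b ⇒ c) → MS4+ ax ⊢ (a ⇒ c)
  _⨾_ {a} {b} {c} f g = mp (mp (taut (Tautologies.syllogism a b c)) f) g

  contra : MS4+ ax ⊢ (a ⇒ b) → MS4+ ax ⊢ (¬' b ⇒ ¬' a)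
  contra {a} {b} = mp (taut (Tautologies.contraposition a b))

  ⇒-to-∨ : MS4+ ax ⊢ ((a ⇒ b) ⇒ (¬' a ∨' b))
  ⇒-to-∨ {a} {b} = taut (Tautologies.⇒-to-∨ a b)

  ∨-to-⇒ : MS4+ ax ⊢ ((¬' a ∨' b) ⇒ (a ⇒ b))
  ∨-to-⇒ {a} {b} = taut (Tautologies.∨-to-⇒ a b)

  ¬¬-elim : MS4+ ax ⊢ (¬' (¬' a) ⇒ a)
  ¬¬-elim {a} = taut (Tautologies.¬¬-elim a)

  ¬¬-intro : MS4+ ax ⊢ (a ⇒ ¬' (¬' a))
  ¬¬-intro {a} = taut (Tautologies.¬¬-intro a)

  contra⁻¹ : MS4+ ax ⊢ (¬' a ⇒ ¬' b) → MS4+ ax ⊢ (b ⇒ a)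
  contra⁻¹ h = ¬¬-intro ⨾ contra h ⨾ ¬¬-elim

  □-mono : MS4+ ax ⊢ (a ⇒ b) → MS4+ ax ⊢ (□ a ⇒ □ b)
  □-mono {a} {b} h = mp (subst (λ { zero → a ; _ → b }) K□) (nec□ h)

  A-mono : MS4+ ax ⊢ (a ⇒ b) → MS4+ ax ⊢ (A a ⇒ A b)
  A-mono {a} {b} h = mp (subst (λ { zero → a ; _ → b }) KA) (necA h)

  ◇-mono : MS4+ ax ⊢ (a ⇒ b) → MS4+ ax ⊢ (◇ a ⇒ ◇ b)
  ◇-mono h = contra (□-mono (contra h))

  ■-mono : MS4+ ax ⊢ (a ⇒ b) → MS4+ ax ⊢ (■ a ⇒ ■ b)
  ■-mono h = □-mono (A-mono h)

  □-T : MS4+ ax ⊢ (□ a ⇒ a)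
  □-T {a} = subst (λ _ → a) T□

  □-4 : MS4+ ax ⊢ (□ a ⇒ □ (□ a))
  □-4 {a} = subst (λ _ → a) 4□

  ■⇒■□ : MS4+ ax ⊢ (■ a ⇒ ■ (□ a))
  ■⇒■□ {a} = □-4 ⨾ □-mono (subst (λ _ → a) lcom)

  ◇∃⇒¬■¬ : MS4+ ax ⊢ (◇ (E a) ⇒ ¬' (■ (¬' a)))
  ◇∃⇒¬■¬ = contra (□-mono ¬¬-intro)

  ¬■¬⇒◇∃ : MS4+ ax ⊢ (¬' (■ (¬' a)) ⇒ ◇ (E a))
  ¬■¬⇒◇∃ = contra (□-mono ¬¬-elim)

module GödelTranslation {ax : Fm} where

  open MS4-Reasoning {ax}

  ⇒ᵗ-intro : ∀ φ ψ → MS4+ ax ⊢ (φ ᵗ ⇒ ψ ᵗ) → MS4+ ax ⊢ ((φ i⇒ ψ) ᵗ)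
  ⇒ᵗ-intro φ ψ h = nec□ (mp ⇒-to-∨ h)

  ⇒ᵗ-elim : ∀ φ ψ → MS4+ ax ⊢ ((φ i⇒ ψ) ᵗ) → MS4+ ax ⊢ (φ ᵗ ⇒ ψ ᵗ)
  ⇒ᵗ-elim φ ψ h = mp ∨-to-⇒ (mp □-T h)

  ¬ᵗ⇒□¬ : ∀ φ → MS4+ ax ⊢ ((i¬ φ) ᵗ ⇒ □ (¬' (φ ᵗ)))
  ¬ᵗ⇒□¬ φ = □-mono ∨-to-⇒

  □¬⇒¬ᵗ : ∀ φ → MS4+ ax ⊢ (□ (¬' (φ ᵗ)) ⇒ (i¬ φ) ᵗ)
  □¬⇒¬ᵗ φ = □-mono ⇒-to-∨

  ¬¬ᵗ⇒□◇ : ∀ φ → MS4+ ax ⊢ ((i¬ (i¬ φ)) ᵗ ⇒ □ (◇ (φ ᵗ)))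
  ¬¬ᵗ⇒□◇ φ = ¬ᵗ⇒□¬ (i¬ φ) ⨾ □-mono (contra (□¬⇒¬ᵗ φ))

  □◇⇒¬¬ᵗ : ∀ φ → MS4+ ax ⊢ (□ (◇ (φ ᵗ)) ⇒ (i¬ (i¬ φ)) ᵗ)
  □◇⇒¬¬ᵗ φ = □-mono (contra (¬ᵗ⇒□¬ φ)) ⨾ □¬⇒¬ᵗ (i¬ φ)

  ∀¬¬ᵗ⇒■◇ : ∀ φ → MS4+ ax ⊢ ((i∀ (i¬ (i¬ φ))) ᵗ ⇒ ■ (◇ (φ ᵗ)))
  ∀¬¬ᵗ⇒■◇ φ = ■-mono (¬¬ᵗ⇒□◇ φ ⨾ □-T)

  ■◇⇒∀¬¬ᵗ : ∀ φ → MS4+ ax ⊢ (■ (◇ (φ ᵗ)) ⇒ (i∀ (i¬ (i¬ φ))) ᵗ)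
  ■◇⇒∀¬¬ᵗ φ = ■⇒■□ ⨾ ■-mono (□◇⇒¬¬ᵗ φ)

open MS4-Reasoning
open GödelTranslation

ax₁⊢kurᵗ : MS4+ ax₁ ⊢ (kur ᵗ)
ax₁⊢kurᵗ = ⇒ᵗ-intro (i∀ (i¬ (i¬ (ivar 0)))) (i¬ (i¬ (i∀ (ivar 0))))
  (□-4 ⨾ □-mono (∀¬¬ᵗ⇒■◇ (ivar 0) ⨾ extra) ⨾ □-mono (◇-mono ■⇒■□) ⨾ □◇⇒¬¬ᵗ (i∀ (ivar 0)))

kurᵗ⊢ax₁ : MS4+ (kur ᵗ) ⊢ ax₁
kurᵗ⊢ax₁ =
  ■◇⇒∀¬¬ᵗ (ivar 0) ⨾ ⇒ᵗ-elim (i∀ (i¬ (i¬ (ivar 0)))) (i¬ (i¬ (i∀ (ivar 0)))) extra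
  ⨾ ¬¬ᵗ⇒□◇ (i∀ (ivar 0)) ⨾ □-T ⨾ ◇-mono (■-mono □-T)

-- Both directions use that ◇□(¬ x) and ¬ □◇x are the same formula.
ax₁⊢ax₂ : MS4+ ax₁ ⊢ ax₂
ax₁⊢ax₂ = □-mono ◇∃⇒¬■¬ ⨾ ¬¬-intro ⨾ contra (subst (λ _ → ¬' p) extra) ⨾ ¬■¬⇒◇∃

ax₂⊢ax₁ : MS4+ ax₂ ⊢ ax₁
ax₂⊢ax₁ = contra⁻¹
  (¬¬-elim ⨾ □-mono (contra (■-mono ¬¬-elim) ⨾ ¬■¬⇒◇∃) ⨾ subst (λ _ → ¬' p) extra
   ⨾ ◇∃⇒¬■¬ ⨾ contra (■-mono (◇-mono (□-mono ¬¬-intro))))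

proposition3p18 : SameLogic GKur⊢_ (MS4+ ax₁ ⊢_) × SameLogic (MS4+ ax₁ ⊢_) (MS4+ ax₂ ⊢_)
proposition3p18 = interderivable⇒SameLogic ax₁⊢kurᵗ kurᵗ⊢ax₁
                , interderivable⇒SameLogic ax₂⊢ax₁ ax₁⊢ax₂
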